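{- Let $\mathbf{n}=(n_1,\dots,n_k)\in\mathbb{Z}_{>0}^k$. If all of the $n_j$ are odd, except possibly a single one of largest value, then $\mathbf{n}$ is a lonely runner instance.
   Context: A vector $\mathbf{n}\in\mathbb{Z}_{>0}^k$ is a lonely runner instance if there exists a real number $t$ such that for all $1\le j\le k$ the distance of $tn_j$ to the nearest integer is at least $\frac{1}{k+1}$. -}

module Defs where

open import Data.Nat using (ℕ; suc; _*_; _≤_; _<_)
open import Data.Integer using (ℤ; +_)
open import Data.Rational as ℚ using (ℚ; _/_; _-_; ∣_∣)
open import Data.Fin using (Fin)
open import Data.Product using (Σ; ∃; _×_)
open import Relation.Binary.PropositionalEquality using (_≡_)

Odd : ℕ → Set
Odd n = Σ ℕ λ m → n ≡ suc (2 * m)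

ℕtoℚ : ℕ → ℚ
ℕtoℚ n = (+ n) / 1

ℤtoℚ : ℤ → ℚ
ℤtoℚ z = z / 1

DistToNearestIntegerAtLeast : ℚ → ℚ → Set
DistToNearestIntegerAtLeast x δ = ∀ (m : ℤ) → δ ℚ.≤ ∣ x - ℤtoℚ m ∣

LonelyRunnerInstance : (k : ℕ) → (Fin k → ℕ) → Set
LonelyRunnerInstance k n =
  ∃ λ (t : ℚ) → ∀ (j : Fin k) →
    DistToNearestIntegerAtLeast (t ℚ.* ℕtoℚ (n j)) ((+ 1) / suc k)

{-# OPTIONS --safe #-}
-- If every speed is odd, at t = 1/2 every runner is at distance 1/2 from the origin. Otherwise the
-- largest speed N is even. For k ≥ 3 take t = 1/2 + 1/(4N): modulo 1 an odd speed x ≤ N is at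
-- 1/2 + x/(4N) ∈ (1/2, 3/4] and N is at 1/4, all at distance ≥ 1/4 ≥ 1/(k+1). For k ≤ 2 the
-- conjecture holds outright: one runner (or two equal ones) at t = 1/(2N); two runners a < N at
-- t = c/(a+N) or, when N < 2a, at t = 2c/(a+N), with c chosen so that c a resp. c (N − a) modulo a+N
-- lies in the middle third. Every distance is checked through one criterion: ‖(A/B) x‖ ≥ 1/K as soon
-- as A x mod B lies in [B/K, B − B/K].
module Submission where

open import Defs
open import Data.Nat using (ℕ; _≤_; _<_)
open import Data.Fin using (Fin)
open import Data.Product using (∃; _×_)
open import Data.Sum using (_⊎_)
open import Relation.Binary.PropositionalEquality using (_≡_)
open import Relation.Nullary using (¬_)

open import Data.Nat.Base as ℕ using (zero; suc; _+_; _*_; NonZero; z≤n; s≤s; z<s)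
import Data.Nat.Properties as ℕ
open import Data.Nat.DivMod using (_%_; m≡m%n+[m/n]*n; m%n<n)
import Data.Nat.Tactic.RingSolver as ℕ-Solver
open import Data.Integer.Base as ℤ using (+_; -[1+_])
import Data.Integer.Properties as ℤ
open import Data.Integer.Tactic.RingSolver using (solve-∀)
open import Data.Rational.Base as ℚ using (ℚ; _/_; toℚᵘ)
import Data.Rational.Properties as ℚ
open import Data.Rational.Unnormalised.Base as ℚᵘ using (mkℚᵘ; *≤*; *≡*)
import Data.Rational.Unnormalised.Properties as ℚᵘ
open import Data.Fin.Patterns using (0F; 1F)
import Data.Fin.Properties as Fin
open import Data.Product using (∃₂; _,_)
open import Data.Sum using (inj₁; inj₂)
open import Relation.Nullary using (yes; no; contradiction)
open import Relation.Binary.PropositionalEquality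
  using (refl; sym; trans; cong; cong₂; subst; subst₂; module ≡-Reasoning)

Lonely : ℕ → ℚ → ℕ → Set
Lonely k t x = DistToNearestIntegerAtLeast (t ℚ.* ℕtoℚ x) ((+ 1) / suc k)

-- With u = y mod B, Balanced K B u v says that y is at distance at least B/K from every multiple of B.
record Balanced (K B u v : ℕ) : Set where
  constructor balanced
  field
    sum   : u + v ≡ B
    left  : B ≤ K * u
    right : B ≤ K * v

∣c*B+u∣≡c*B+u : ∀ c B u → ℤ.∣ + c ℤ.* + B ℤ.+ + u ∣ ≡ c * B + u
∣c*B+u∣≡c*B+u c B u = cong (λ z → ℤ.∣ z ℤ.+ + u ∣) (sym (ℤ.pos-* c B))

u≤∣z*B+u∣⊎v≤∣z*B+u∣ : ∀ z {u v B} → u + v ≡ B →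
  u ≤ ℤ.∣ z ℤ.* + B ℤ.+ + u ∣ ⊎ v ≤ ℤ.∣ z ℤ.* + B ℤ.+ + u ∣
u≤∣z*B+u∣⊎v≤∣z*B+u∣ (+ c) {u} {B = B} refl =
  inj₁ (subst (u ≤_) (sym (∣c*B+u∣≡c*B+u c B u)) (ℕ.m≤n+m u (c * B)))
u≤∣z*B+u∣⊎v≤∣z*B+u∣ -[1+ c ] {u} {v} refl =
  inj₂ (subst (v ≤_) (sym ∣-[1+c]*B+u∣) (ℕ.m≤n+m v (c * (u + v))))
  where
  open ≡-Reasoning
  negate : ∀ c u v → ℤ.- (+ 1 ℤ.+ c) ℤ.* (u ℤ.+ v) ℤ.+ u ≡ ℤ.- (c ℤ.* (u ℤ.+ v) ℤ.+ v)
  negate = solve-∀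
  ∣-[1+c]*B+u∣ : ℤ.∣ -[1+ c ] ℤ.* + (u + v) ℤ.+ + u ∣ ≡ c * (u + v) + v
  ∣-[1+c]*B+u∣ = begin
    ℤ.∣ -[1+ c ] ℤ.* + (u + v) ℤ.+ + u ∣       ≡⟨ cong ℤ.∣_∣ (negate (+ c) (+ u) (+ v)) ⟩
    ℤ.∣ ℤ.- (+ c ℤ.* + (u + v) ℤ.+ + v) ∣      ≡⟨ ℤ.∣-i∣≡∣i∣ (+ c ℤ.* + (u + v) ℤ.+ + v) ⟩
    ℤ.∣ + c ℤ.* + (u + v) ℤ.+ + v ∣            ≡⟨ ∣c*B+u∣≡c*B+u c (u + v) v ⟩
    c * (u + v) + v                           ∎

balanced⇒far-from-multiples : ∀ {K B y u v} q → y ≡ q * B + u → Balanced K B u v →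
  ∀ m → B ≤ K * ℤ.∣ + y ℤ.- m ℤ.* + B ∣
balanced⇒far-from-multiples {K} {B} {u = u} {v} q refl (balanced u+v≡B B≤Ku B≤Kv) m =
  subst (λ d → B ≤ K * ℤ.∣ d ∣) (sym regroup) (scale (u≤∣z*B+u∣⊎v≤∣z*B+u∣ (+ q ℤ.- m) u+v≡B))
  where
  shift : ∀ q B u m → q ℤ.* B ℤ.+ u ℤ.- m ℤ.* B ≡ (q ℤ.- m) ℤ.* B ℤ.+ u
  shift = solve-∀
  regroup : + (q * B + u) ℤ.- m ℤ.* + B ≡ (+ q ℤ.- m) ℤ.* + B ℤ.+ + u
  regroup = trans (cong (λ z → z ℤ.+ + u ℤ.- m ℤ.* + B) (ℤ.pos-* q B)) (shift (+ q) (+ B) (+ u) m)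
  scale : ∀ {d} → u ≤ d ⊎ v ≤ d → B ≤ K * d
  scale (inj₁ u≤d) = ℕ.≤-trans B≤Ku (ℕ.*-monoʳ-≤ K u≤d)
  scale (inj₂ v≤d) = ℕ.≤-trans B≤Kv (ℕ.*-monoʳ-≤ K v≤d)

toℚᵘ-/ : ∀ z b → toℚᵘ (z / suc b) ℚᵘ.≃ mkℚᵘ z b
toℚᵘ-/ z b = ℚ.toℚᵘ-fromℚᵘ (mkℚᵘ z b)

toℚᵘ-A/B*x-m : ∀ A b x m →
  toℚᵘ (((+ A) / suc b) ℚ.* ℕtoℚ x ℚ.- ℤtoℚ m) ℚᵘ.≃ mkℚᵘ (+ (A * x) ℤ.- m ℤ.* + suc b) b
toℚᵘ-A/B*x-m A b x m = begin
  toℚᵘ (t ℚ.* ℕtoℚ x ℚ.- ℤtoℚ m)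
    ≈⟨ ℚ.toℚᵘ-homo-+ (t ℚ.* ℕtoℚ x) (ℚ.- ℤtoℚ m) ⟩
  toℚᵘ (t ℚ.* ℕtoℚ x) ℚᵘ.+ toℚᵘ (ℚ.- ℤtoℚ m)
    ≈⟨ ℚᵘ.+-cong (ℚᵘ.≃-trans (ℚ.toℚᵘ-homo-* t (ℕtoℚ x)) (ℚᵘ.*-cong (toℚᵘ-/ (+ A) b) (toℚᵘ-/ (+ x) 0)))
                 (ℚᵘ.≃-trans (ℚ.toℚᵘ-homo‿- (ℤtoℚ m)) (ℚᵘ.-‿cong (toℚᵘ-/ m 0))) ⟩
  mkℚᵘ (+ A) b ℚᵘ.* mkℚᵘ (+ x) 0 ℚᵘ.+ ℚᵘ.- mkℚᵘ m 0
    ≈⟨ *≡* cross-multiplied ⟩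
  mkℚᵘ (+ (A * x) ℤ.- m ℤ.* + suc b) b ∎
  where
  open ℚᵘ.≃-Reasoning
  t = (+ A) / suc b
  cross : ∀ a c m B → (a ℤ.* c ℤ.* + 1 ℤ.+ ℤ.- m ℤ.* B) ℤ.* B ≡ (a ℤ.* c ℤ.- m ℤ.* B) ℤ.* B
  cross = solve-∀
  cross-multiplied : (+ A ℤ.* + x ℤ.* + 1 ℤ.+ ℤ.- m ℤ.* + (suc b * 1)) ℤ.* + suc b
                   ≡ (+ (A * x) ℤ.- m ℤ.* + suc b) ℤ.* + (suc b * 1 * 1)
  cross-multiplied =
    trans (cong (λ B → (+ A ℤ.* + x ℤ.* + 1 ℤ.+ ℤ.- m ℤ.* B) ℤ.* + suc b) B*1≡B)
      (trans (cross (+ A) (+ x) m (+ suc b))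
        (cong₂ (λ ax B → (ax ℤ.- m ℤ.* + suc b) ℤ.* B) (sym (ℤ.pos-* A x)) (sym B*1*1≡B)))
    where
    B*1≡B : + (suc b * 1) ≡ + suc b
    B*1≡B = cong +_ (ℕ.*-identityʳ (suc b))
    B*1*1≡B : + (suc b * 1 * 1) ≡ + suc b
    B*1*1≡B = cong +_ (trans (ℕ.*-identityʳ (suc b * 1)) (ℕ.*-identityʳ (suc b)))

1/K≤d/B : ∀ {k b d} → suc b ≤ suc k * d → mkℚᵘ (+ 1) k ℚᵘ.≤ mkℚᵘ (+ d) b
1/K≤d/B {k} {b} {d} B≤Kd = *≤* (subst₂ ℤ._≤_ (sym (ℤ.*-identityˡ (+ suc b))) (ℤ.pos-* d (suc k))
  (ℤ.+≤+ (subst (suc b ≤_) (ℕ.*-comm (suc k) d) B≤Kd)))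

lonely-if-residue : ∀ {k u v} A B .{{_ : NonZero B}} x q →
  A * x ≡ q * B + u → Balanced (suc k) B u v → Lonely k ((+ A) / B) x
lonely-if-residue A zero {{()}} x
lonely-if-residue {k} A (suc b) x q division bal m = ℚ.toℚᵘ-cancel-≤ (begin
  toℚᵘ ((+ 1) / suc k)                        ≃⟨ toℚᵘ-/ (+ 1) k ⟩
  mkℚᵘ (+ 1) k                                ≤⟨ 1/K≤d/B (balanced⇒far-from-multiples q division bal m) ⟩
  ℚᵘ.∣ mkℚᵘ (+ (A * x) ℤ.- m ℤ.* + suc b) b ∣ ≃⟨ ℚᵘ.∣-∣-cong (toℚᵘ-A/B*x-m A b x m) ⟨
  ℚᵘ.∣ toℚᵘ (t ℚ.* ℕtoℚ x ℚ.- ℤtoℚ m) ∣       ≃⟨ ℚ.toℚᵘ-homo-∣-∣ (t ℚ.* ℕtoℚ x ℚ.- ℤtoℚ m) ⟨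
  toℚᵘ ℚ.∣ t ℚ.* ℕtoℚ x ℚ.- ℤtoℚ m ∣         ∎)
  where
  open ℚᵘ.≤-Reasoning
  t = (+ A) / suc b

balanced-mono : ∀ {K K′ B u v} → K ≤ K′ → Balanced K B u v → Balanced K′ B u v
balanced-mono {u = u} {v} K≤K′ (balanced u+v≡B B≤Ku B≤Kv) =
  balanced u+v≡B (ℕ.≤-trans B≤Ku (ℕ.*-monoˡ-≤ u K≤K′)) (ℕ.≤-trans B≤Kv (ℕ.*-monoˡ-≤ v K≤K′))

balanced-swap : ∀ {K B u v} → Balanced K B u v → Balanced K B v u
balanced-swap {u = u} {v} (balanced u+v≡B B≤Ku B≤Kv) =
  balanced (trans (ℕ.+-comm v u) u+v≡B) B≤Kv B≤Ku

complement-residue : ∀ {y u v B} c → u + v ≡ B → y + u ≡ suc c * B → y ≡ c * B + v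
complement-residue {y} {u} {v} c refl y+u≡ = ℕ.+-cancelʳ-≡ u y (c * (u + v) + v)
  (trans y+u≡ (regroup c u v))
  where
  regroup : ∀ c u v → suc c * (u + v) ≡ c * (u + v) + v + u
  regroup = ℕ-Solver.solve-∀

-- Writing s = r + (q + 1) · 3e with r < 3e, the multiple (q + 2) e lies in [s/3, 2s/3].
multiple-in-middle-third : ∀ {e s} → 0 < e → 3 * e ≤ s → ∃₂ λ c v → Balanced 3 s (suc c * e) v
multiple-in-middle-third {suc e′} {s} _ 3e≤s
  with s ℕ./ (3 * suc e′) | s % (3 * suc e′) | m≡m%n+[m/n]*n s (3 * suc e′) | m%n<n s (3 * suc e′)
... | zero  | r | refl | r<3e =
  contradiction 3e≤s (ℕ.<⇒≱ (subst (_< 3 * suc e′) (sym (ℕ.+-identityʳ r)) r<3e))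
... | suc q | r | refl | r<3e = suc q , r + e * (2 * q + 1) , balanced (sum r e q) left right
  where
  e = suc e′
  sum : ∀ r e q → (2 + q) * e + (r + e * (2 * q + 1)) ≡ r + (1 + q) * (3 * e)
  sum = ℕ-Solver.solve-∀
  upper : ∀ e q → 3 * e + (1 + q) * (3 * e) ≡ 3 * ((2 + q) * e)
  upper = ℕ-Solver.solve-∀
  lower : ∀ r e q → r + (1 + q) * (3 * e) + (2 * r + 3 * e * q) ≡ 3 * (r + e * (2 * q + 1))
  lower = ℕ-Solver.solve-∀
  left : r + suc q * (3 * e) ≤ 3 * (suc (suc q) * e)
  left = ℕ.≤-trans (ℕ.+-monoˡ-≤ (suc q * (3 * e)) (ℕ.<⇒≤ r<3e)) (ℕ.≤-reflexive (upper e q))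
  right : r + suc q * (3 * e) ≤ 3 * (r + e * (2 * q + 1))
  right = subst (r + suc q * (3 * e) ≤_) (lower r e q) (ℕ.m≤m+n _ (2 * r + 3 * e * q))

odd-lonely-at-half : ∀ {k x} → Odd x → Lonely (suc k) ((+ 1) / 2) x
odd-lonely-at-half {k} (m , refl) = lonely-if-residue {suc k} 1 2 (suc (2 * m)) m (identity m)
  (balanced refl (s≤s (s≤s z≤n)) (s≤s (s≤s z≤n)))
  where
  identity : ∀ m → 1 * suc (2 * m) ≡ m * 2 + 1
  identity = ℕ-Solver.solve-∀

n+n≡2*n : ∀ n → n + n ≡ 2 * n
n+n≡2*n = ℕ-Solver.solve-∀

one-runner : ∀ {k N} → 1 ≤ k → 0 < N → ∃ λ t → Lonely k t N
one-runner {k} {suc N} 1≤k _ =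
  (+ 1) / (2 * suc N) ,
  lonely-if-residue {k} 1 (2 * suc N) (suc N) 0 (ℕ.*-identityˡ (suc N))
    (balanced (n+n≡2*n (suc N)) 2N≤KN 2N≤KN)
  where
  2N≤KN : 2 * suc N ≤ suc k * suc N
  2N≤KN = ℕ.*-monoˡ-≤ (suc N) (s≤s 1≤k)

n+[n+n]≡3*n : ∀ n → n + (n + n) ≡ 3 * n
n+[n+n]≡3*n = ℕ-Solver.solve-∀

-- At t = c/s the positions t a and t (a + d) add up to the integer c.
two-runners-far-apart : ∀ {a d} → 0 < a → a ≤ d → ∃ λ t → Lonely 2 t a × Lonely 2 t (a + d)
two-runners-far-apart {a@(suc _)} {d} 0<a a≤d = runners (multiple-in-middle-third 0<a 3a≤s)
  where
  s = a + (a + d)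
  3a≤s : 3 * a ≤ s
  3a≤s = subst (_≤ s) (n+[n+n]≡3*n a) (ℕ.+-monoʳ-≤ a (ℕ.+-monoʳ-≤ a a≤d))
  runners : (∃₂ λ c v → Balanced 3 s (suc c * a) v) → ∃ λ t → Lonely 2 t a × Lonely 2 t (a + d)
  runners (c , v , bal) =
    (+ suc c) / s ,
    lonely-if-residue (suc c) s a 0 refl bal ,
    lonely-if-residue (suc c) s (a + d) c (complement-residue c (Balanced.sum bal) (identity c a d))
      (balanced-swap bal)
    where
    identity : ∀ c a d → suc c * (a + d) + suc c * a ≡ suc c * (a + (a + d))
    identity = ℕ-Solver.solve-∀

-- At t = 2c/s, modulo 1, t a ≡ − c d/s and t (a + d) ≡ c d/s.
two-runners-close : ∀ {a d} → 0 < d → d ≤ a → ∃ λ t → Lonely 2 t a × Lonely 2 t (a + d)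
two-runners-close {zero} z<s ()
two-runners-close {a@(suc _)} {d} 0<d d≤a = runners (multiple-in-middle-third 0<d 3d≤s)
  where
  s = a + (a + d)
  3d≤s : 3 * d ≤ s
  3d≤s = subst (_≤ s) (n+[n+n]≡3*n d) (ℕ.+-mono-≤ d≤a (ℕ.+-monoˡ-≤ d d≤a))
  runners : (∃₂ λ c v → Balanced 3 s (suc c * d) v) → ∃ λ t → Lonely 2 t a × Lonely 2 t (a + d)
  runners (c , v , bal) =
    (+ (2 * suc c)) / s ,
    lonely-if-residue (2 * suc c) s a c (complement-residue c (Balanced.sum bal) (identityₐ c a d))
      (balanced-swap bal) ,
    lonely-if-residue (2 * suc c) s (a + d) (suc c) (identityₙ c a d) bal
    where
    identityₐ : ∀ c a d → 2 * suc c * a + suc c * d ≡ suc c * (a + (a + d))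
    identityₐ = ℕ-Solver.solve-∀
    identityₙ : ∀ c a d → 2 * suc c * (a + d) ≡ suc c * (a + (a + d)) + suc c * d
    identityₙ = ℕ-Solver.solve-∀

two-runners : ∀ {a N} → 0 < a → a ≤ N → ∃ λ t → Lonely 2 t a × Lonely 2 t N
two-runners {a} 0<a a≤N with ℕ.m≤n⇒∃[o]m+o≡n a≤N
... | zero , refl rewrite ℕ.+-identityʳ a =
  let t , lonely = one-runner {2} (s≤s z≤n) 0<a in t , lonely , lonely
... | suc d , refl with ℕ.≤-total a (suc d)
...   | inj₁ a≤d = two-runners-far-apart 0<a a≤d
...   | inj₂ d≤a = two-runners-close z<s d≤a

lonely-runner-conjecture₁ : (n : Fin 1 → ℕ) → (∀ j → 0 < n j) → LonelyRunnerInstance 1 n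
lonely-runner-conjecture₁ n pos = let t , lonely = one-runner ℕ.≤-refl (pos 0F) in t , λ { 0F → lonely }

lonely-runner-conjecture₂ : (n : Fin 2 → ℕ) → (∀ j → 0 < n j) → LonelyRunnerInstance 2 n
lonely-runner-conjecture₂ n pos with ℕ.≤-total (n 0F) (n 1F)
... | inj₁ n₀≤n₁ = let t , lonely₀ , lonely₁ = two-runners (pos 0F) n₀≤n₁
                  in t , λ { 0F → lonely₀ ; 1F → lonely₁ }
... | inj₂ n₁≤n₀ = let t , lonely₁ , lonely₀ = two-runners (pos 1F) n₁≤n₀
                  in t , λ { 0F → lonely₀ ; 1F → lonely₁ }

odd-speeds-instance : ∀ {k} (n : Fin (suc k) → ℕ) → (∀ j → Odd (n j)) → LonelyRunnerInstance (suc k) n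
odd-speeds-instance {k} n odd = (+ 1) / 2 , λ j → odd-lonely-at-half {k} (odd j)

Even : ℕ → Set
Even n = ∃ λ q → n ≡ 2 * q

even-or-odd : ∀ n → Even n ⊎ Odd n
even-or-odd zero = inj₁ (0 , refl)
even-or-odd (suc n) with even-or-odd n
... | inj₁ (q , refl) = inj₂ (q , refl)
... | inj₂ (m , refl) = inj₁ (suc m , cong suc (sym (ℕ.+-suc m (m + 0))))

balanced-quarters : ∀ {M u v} → M ≤ u → M ≤ v → u + v ≡ 4 * M → Balanced 4 (4 * M) u v
balanced-quarters M≤u M≤v u+v≡4M = balanced u+v≡4M (ℕ.*-monoʳ-≤ 4 M≤u) (ℕ.*-monoʳ-≤ 4 M≤v)

odd-below-lonely : ∀ {k N x} → 3 ≤ k → Odd x → x ≤ suc N →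
  Lonely k ((+ (2 * suc N + 1)) / (4 * suc N)) x
odd-below-lonely {k} {N} {x} 3≤k (p , refl) x≤M with ℕ.m≤n⇒∃[o]m+o≡n x≤M
... | w , x+w≡M = lonely-if-residue (2 * M + 1) (4 * M) x p (residue M p)
  (balanced-mono (s≤s 3≤k) (balanced-quarters M≤u (ℕ.m≤m+n M w) sum))
  where
  M = suc N
  residue : ∀ M p → (2 * M + 1) * suc (2 * p) ≡ p * (4 * M) + (2 * M + suc (2 * p))
  residue = ℕ-Solver.solve-∀
  M≤u : M ≤ 2 * M + x
  M≤u = ℕ.≤-trans (ℕ.m≤m+n M (M + 0)) (ℕ.m≤m+n (2 * M) x)
  sum : 2 * M + x + (M + w) ≡ 4 * M
  sum = begin
    2 * M + x + (M + w) ≡⟨ regroup M x w ⟩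
    3 * M + (x + w)     ≡⟨ cong (λ y → 3 * M + y) x+w≡M ⟩
    3 * M + M           ≡⟨ ℕ.+-comm (3 * M) M ⟩
    4 * M               ∎
    where
    open ≡-Reasoning
    regroup : ∀ M x w → 2 * M + x + (M + w) ≡ 3 * M + (x + w)
    regroup = ℕ-Solver.solve-∀

even-lonely : ∀ {k N} → 3 ≤ k → Even (suc N) → Lonely k ((+ (2 * suc N + 1)) / (4 * suc N)) (suc N)
even-lonely {k} {N} 3≤k (q , M≡2q) = lonely-if-residue (2 * M + 1) (4 * M) M q residue
  (balanced-mono (s≤s 3≤k) (balanced-quarters ℕ.≤-refl (ℕ.m≤m+n M (2 * M)) refl))
  where
  M = suc N
  residue : (2 * M + 1) * M ≡ q * (4 * M) + M
  residue = begin
    (2 * M + 1) * M     ≡⟨ expand M ⟩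
    2 * M * M + M       ≡⟨ cong (λ y → 2 * M * y + M) M≡2q ⟩
    2 * M * (2 * q) + M ≡⟨ regroup M q ⟩
    q * (4 * M) + M     ∎
    where
    open ≡-Reasoning
    expand : ∀ M → (2 * M + 1) * M ≡ 2 * M * M + M
    expand = ℕ-Solver.solve-∀
    regroup : ∀ M q → 2 * M * (2 * q) + M ≡ q * (4 * M) + M
    regroup = ℕ-Solver.solve-∀

even-maximum-instance : ∀ {k M} (n : Fin k → ℕ) → 3 ≤ k → 0 < M → Even M →
  (∀ j → n j ≤ M) → (∀ j → Odd (n j) ⊎ n j ≡ M) → LonelyRunnerInstance k n
even-maximum-instance {k} {suc N} n 3≤k _ even bounded odd-or-maximum = t , lonely
  where
  t = (+ (2 * suc N + 1)) / (4 * suc N)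
  lonely : ∀ j → Lonely k t (n j)
  lonely j with odd-or-maximum j
  ... | inj₁ odd = odd-below-lonely 3≤k odd (bounded j)
  ... | inj₂ nⱼ≡M = subst (Lonely k t) (sym nⱼ≡M) (even-lonely 3≤k even)

odd-or-equal : ∀ {k i} {n : Fin k → ℕ} → (∀ j → ¬ (j ≡ i) → Odd (n j)) → ∀ j → Odd (n j) ⊎ n j ≡ n i
odd-or-equal {i = i} others-odd j with j Fin.≟ i
... | yes refl = inj₂ refl
... | no j≢i = inj₁ (others-odd j j≢i)

odd-everywhere : ∀ {k i} {n : Fin k → ℕ} → Odd (n i) → (∀ j → ¬ (j ≡ i) → Odd (n j)) → ∀ j → Odd (n j)
odd-everywhere {i = i} oddᵢ others-odd j with j Fin.≟ i
... | yes refl = oddᵢ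
... | no j≢i = others-odd j j≢i

corollary6 : (k : ℕ) (n : Fin k → ℕ) →
    (∀ j → 0 < n j) →
    ((∀ j → Odd (n j))
      ⊎ (∃ λ (i : Fin k) → (∀ j → n j ≤ n i) × (∀ j → ¬ (j ≡ i) → Odd (n j)))) →
    LonelyRunnerInstance k n
corollary6 zero n _ _ = ℚ.0ℚ , λ ()
corollary6 1 n pos _ = lonely-runner-conjecture₁ n pos
corollary6 2 n pos _ = lonely-runner-conjecture₂ n pos
corollary6 (suc (suc (suc _))) n _ (inj₁ all-odd) = odd-speeds-instance n all-odd
corollary6 (suc (suc (suc _))) n pos (inj₂ (i , maximal , others-odd)) with even-or-odd (n i)
... | inj₁ even =
  even-maximum-instance n (s≤s (s≤s (s≤s z≤n))) (pos i) even maximal (odd-or-equal others-odd)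
... | inj₂ odd = odd-speeds-instance n (odd-everywhere odd others-odd)
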